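{- Let $G$ be an edge-labelled graph and $A$ a $\Delta$-implication class of $G$ such that for every $(u,v)\in A$, $uv$ is an overlap edge. Then $span(A)$ induces a clique in $G$.
   Context: An edge-labelled graph is a finite graph $G=(V,E)$ with a loop at every vertex, in which every edge is labelled either "inclusion edge" or "overlap edge" (loops are labelled inclusion); labels need not reflect neighbourhoods. $u$ overlaps $v$ if $uv$ is an overlap edge. A vertex $z$ avoids the edge $xy$ (possibly $x=y$) if every neighbour of $z$ among $x,y$ overlaps $z$, and whenever $z$ overlaps both $x$ and $y$, $xy$ is an inclusion edge. Whenever an edge $xy$ avoids $z$ we write $(x,z)\,\Delta\,(y,z)$ and $(z,x)\,\Delta\,(z,y)$. An ordered pair $(a,b)$ is related to $(u,v)$ if there is a sequence $(a,b)=(p_0,q_0)\,\Delta\,(p_1,q_1)\,\Delta\cdots\Delta\,(p_m,q_m)=(u,v)$ with $m\ge 1$. A $\Delta$-implication class is a maximal set of ordered pairs that are pairwise related. $span(A)$ is the set of vertices $u$ such that $(u,v)\in A$ or $(v,u)\in A$ for some $v$. -}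

module Defs where

open import Data.Nat using (ℕ)
open import Data.Fin using (Fin)
open import Data.Bool using (Bool; true)
open import Data.Product using (_×_; _,_; ∃)
open import Data.Sum using (_⊎_)
open import Relation.Binary.PropositionalEquality using (_≡_)
open import Relation.Binary.Construct.Closure.Transitive using (TransClosure)

data Label : Set where
  inclusion overlapping : Label

-- A finite edge-labelled graph on vertex set Fin n: symmetric adjacency with a
-- loop at every vertex, and a symmetric labelling (only meaningful on edges);
-- loops are labelled inclusion.
record ELGraph (n : ℕ) : Set where
  field
    adj       : Fin n → Fin n → Bool
    adj-sym   : ∀ x y → adj x y ≡ adj y x
    adj-loop  : ∀ x → adj x x ≡ true
    label     : Fin n → Fin n → Label
    label-sym : ∀ x y → label x y ≡ label y x
    label-loop : ∀ x → label x x ≡ inclusion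

module _ {n : ℕ} (G : ELGraph n) where
  open ELGraph G

  Edge : Fin n → Fin n → Set
  Edge x y = adj x y ≡ true

  Overlaps : Fin n → Fin n → Set
  Overlaps x y = Edge x y × label x y ≡ overlapping

  InclusionEdge : Fin n → Fin n → Set
  InclusionEdge x y = Edge x y × label x y ≡ inclusion

  Avoids : Fin n → Fin n → Fin n → Set
  Avoids z x y =
    Edge x y
    × (Edge z x → Overlaps z x)
    × (Edge z y → Overlaps z y)
    × (Overlaps z x → Overlaps z y → InclusionEdge x y)

  Pair : Set
  Pair = Fin n × Fin n

  data Δ : Pair → Pair → Set where
    Δ-left  : ∀ {x y z} → Avoids z x y → Δ (x , z) (y , z)
    Δ-right : ∀ {x y z} → Avoids z x y → Δ (z , x) (z , y)

  Related : Pair → Pair → Set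
  Related = TransClosure Δ

  PairwiseRelated : (Pair → Set) → Set
  PairwiseRelated A = ∀ p q → A p → A q → Related p q

  ImplicationClass : (Pair → Set) → Set₁
  ImplicationClass A =
    PairwiseRelated A
    × (∀ (B : Pair → Set) → (∀ p → A p → B p) → PairwiseRelated B → ∀ p → B p → A p)

  span : (Pair → Set) → Fin n → Set
  span A u = ∃ λ v → A (u , v) ⊎ A (v , u)

  IsClique : (Fin n → Set) → Set
  IsClique S = ∀ u w → S u → S w → Edge u w

module Submission where

-- By maximality and the symmetry of Δ, an implication class is closed under Δ.
-- If (x , z) lies in a Δ-closed class of overlap pairs and w is adjacent to z,
-- then w is adjacent to x: otherwise x avoids the edge zw, so (x , z) Δ (x , w)
-- puts the non-edge xw into the class.  Hence a common neighbour of one pair of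
-- the class is a common neighbour of every Δ-related pair, and each vertex of the
-- span is a common neighbour of its own pair (via its loop).

open import Defs
open import Data.Nat using (ℕ)
open import Data.Fin using (Fin)
open import Data.Bool using (true; _≟_)
open import Data.Product using (_×_; _,_; proj₁; proj₂; swap; ∃)
open import Function.Base using (_∘_)
open import Data.Sum using (inj₁; inj₂)
open import Relation.Nullary using (¬_; yes; no; contradiction)
open import Relation.Binary.Definitions using (_Respects_)
open import Relation.Binary.PropositionalEquality using (trans)
open import Relation.Binary.Construct.Closure.Transitive
  using (TransClosure; [_]; _∷_; _++_; symmetric)

respects-closure : ∀ {A : Set} {R : A → A → Set} {P : A → Set} →
  P Respects R → P Respects TransClosure R
respects-closure resp [ r ]    = resp r
respects-closure resp (r ∷ rs) = respects-closure resp rs ∘ resp r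

module _ {n : ℕ} (G : ELGraph n) where
  open ELGraph G

  edge-sym : ∀ {x y} → Edge G x y → Edge G y x
  edge-sym {x} {y} e = trans (adj-sym y x) e

  overlaps-sym : ∀ {x y} → Overlaps G x y → Overlaps G y x
  overlaps-sym {x} {y} (e , l) = edge-sym e , trans (label-sym y x) l

  inclusionEdge-sym : ∀ {x y} → InclusionEdge G x y → InclusionEdge G y x
  inclusionEdge-sym {x} {y} (e , l) = edge-sym e , trans (label-sym y x) l

  avoids-sym : ∀ {z x y} → Avoids G z x y → Avoids G z y x
  avoids-sym (e , ox , oy , incl) =
    edge-sym e , oy , ox , λ o₁ o₂ → inclusionEdge-sym (incl o₂ o₁)

  Δ-sym : ∀ {p q} → Δ G p q → Δ G q p
  Δ-sym (Δ-left av)  = Δ-left (avoids-sym av)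
  Δ-sym (Δ-right av) = Δ-right (avoids-sym av)

  Δ-swap : ∀ {p q} → Δ G p q → Δ G (swap p) (swap q)
  Δ-swap (Δ-left av)  = Δ-right av
  Δ-swap (Δ-right av) = Δ-left av

  related-sym : ∀ {p q} → Related G p q → Related G q p
  related-sym = symmetric (Δ G) Δ-sym

  implicationClass-respects-related : ∀ {A} → ImplicationClass G A →
    A Respects Related G
  implicationClass-respects-related {A} (pairwise , maximal) {p} {q} p~q Ap =
    maximal (Related G p) (λ r Ar → pairwise p r Ap Ar) related-pairwise q p~q
    where
    related-pairwise : PairwiseRelated G (Related G p)
    related-pairwise r s p~r p~s = related-sym p~r ++ p~s

  nonadjacent-avoids : ∀ {x z w} → ¬ Edge G x w → Overlaps G x z → Edge G z w →
    Avoids G x z w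
  nonadjacent-avoids ¬xw xz zw =
    zw , (λ _ → xz) , (λ xw → contradiction xw ¬xw) , (λ _ xw → contradiction (proj₁ xw) ¬xw)

  module _ {S : Pair G → Set} (closed : S Respects Δ G)
           (overlaps : ∀ {u v} → S (u , v) → Overlaps G u v) where

    adjacent-to-first : ∀ {x z w} → S (x , z) → Edge G z w → Edge G x w
    adjacent-to-first {x} {z} {w} Sxz zw with adj x w ≟ true
    ... | yes xw = xw
    ... | no ¬xw = proj₁ (overlaps (closed (Δ-right avoid) Sxz))
      where
      avoid : Avoids G x z w
      avoid = nonadjacent-avoids ¬xw (overlaps Sxz) zw

  CommonNeighbour : Fin n → Pair G → Set
  CommonNeighbour u (a , b) = Edge G u a × Edge G u b

  module _ {S : Pair G → Set} (closed : S Respects Δ G)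
           (overlaps : ∀ {u v} → S (u , v) → Overlaps G u v) where

    adjacent-to-second : ∀ {x z w} → S (z , x) → Edge G z w → Edge G x w
    adjacent-to-second =
      adjacent-to-first (λ p~q → closed (Δ-swap p~q)) (λ Szx → overlaps-sym (overlaps Szx))

    commonNeighbour-respects-Δ : ∀ u → (λ p → S p × CommonNeighbour u p) Respects Δ G
    commonNeighbour-respects-Δ u p~q@(Δ-left _) (Sp , _ , uz) =
      Sq , edge-sym (adjacent-to-first closed overlaps Sq (edge-sym uz)) , uz
      where Sq = closed p~q Sp
    commonNeighbour-respects-Δ u p~q@(Δ-right _) (Sp , uz , _) =
      Sq , uz , edge-sym (adjacent-to-second Sq (edge-sym uz))
      where Sq = closed p~q Sp

  span-commonNeighbour : ∀ {A : Pair G → Set} {u} →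
    (∀ {x y} → A (x , y) → Overlaps G x y) →
    span G A u → ∃ λ p → A p × CommonNeighbour u p
  span-commonNeighbour {u = u} overlaps (v , inj₁ Auv) =
    (u , v) , Auv , adj-loop u , proj₁ (overlaps Auv)
  span-commonNeighbour {u = u} overlaps (v , inj₂ Avu) =
    (v , u) , Avu , edge-sym (proj₁ (overlaps Avu)) , adj-loop u

  implicationClass-commonNeighbour : ∀ {A : Pair G → Set} {u r} →
    ImplicationClass G A → (∀ {x y} → A (x , y) → Overlaps G x y) →
    span G A u → A r → CommonNeighbour u r
  implicationClass-commonNeighbour {A} {u} {r} class overlaps u∈span Ar
    with span-commonNeighbour overlaps u∈span
  ... | p , Ap , up = proj₂ (respects-closure invariant (proj₁ class p r Ap Ar) (Ap , up))
    where
    invariant : (λ q → A q × CommonNeighbour u q) Respects Δ G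
    invariant = commonNeighbour-respects-Δ
      (λ q~q′ → implicationClass-respects-related class [ q~q′ ]) overlaps u

corollary19 : (n : ℕ) (G : ELGraph n) (A : Pair G → Set) →
    ImplicationClass G A →
    (∀ u v → A (u , v) → Overlaps G u v) →
    IsClique G (span G A)
corollary19 n G A class overlaps u w u∈span (v , inj₁ Awv) =
  proj₁ (implicationClass-commonNeighbour G class (overlaps _ _) u∈span Awv)
corollary19 n G A class overlaps u w u∈span (v , inj₂ Avw) =
  proj₂ (implicationClass-commonNeighbour G class (overlaps _ _) u∈span Avw)
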